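{- For $n\ge 0$, there is a bijection between the set $O_{2n,2}$ of oscillating domino tableaux of length $2n$ in which every shape has at most two columns and the set $P_{2n}$ of Dyck path packings of length $2n$.
   Context: Partitions are identified with Young diagrams. A domino is a $2$-rim hook: for Young diagrams $\mu\subseteq\nu$, $\nu$ is obtained from $\mu$ by adding a domino (equivalently $\mu$ from $\nu$ by deleting one) if $\nu/\mu$ consists of two edgewise adjacent cells. An oscillating domino tableau of length $2n$ is a sequence $(\lambda^0,\ldots,\lambda^{2n})$ of Young diagrams with $\lambda^0=\lambda^{2n}=\emptyset$ such that each $\lambda^i$ is obtained from $\lambda^{i-1}$ by adding or deleting a domino. A Dyck path of length $2n$ is a lattice path from $(0,0)$ to $(2n,0)$ with steps $(1,1)$ and $(1,-1)$ never going below the $x$-axis. A dispersed Dyck path of length $2n$ is a lattice path from $(0,0)$ to $(2n,0)$ with steps $(1,1)$, $(1,-1)$, $(1,0)$ never going below the $x$-axis, in which every $(1,0)$ step lies on the $x$-axis. A Dyck path packing of length $2n$ is a pair $(D,E)$ where $D$ is a Dyck path of length $2n$ and $E$ is a dispersed Dyck path of length $2n$ that never goes above $D$ (i.e. at each abscissa $0\le i\le 2n$ the height of $E$ is at most that of $D$). -}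

module Defs where

open import Data.Nat using (ℕ; zero; suc; _+_; _*_; _≤_; _<_; _≥_)
open import Data.Integer as ℤ using (ℤ; +_)
open import Data.List using (List; []; _∷_; length; head; last; take)
open import Data.List.Relation.Unary.All using (All)
open import Data.List.Relation.Unary.Linked using (Linked)
open import Data.Maybe using (just)
open import Data.Product using (Σ; ∃; _×_; _,_; proj₁)
open import Data.Sum using (_⊎_)
open import Data.Empty using (⊥)
open import Data.List using (_++_)
open import Relation.Binary.PropositionalEquality using (_≡_)

-- Partitions / Young diagrams
-- A partition is a list of row lengths λ₀ ≥ λ₁ ≥ … > 0 (English notation:
-- row i has λ_i cells).  The empty partition is [].

IsPartition : List ℕ → Set
IsPartition λ′ = Linked _≥_ λ′ × All (λ k → 0 < k) λ′

YoungDiagram : Set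
YoungDiagram = Σ (List ℕ) IsPartition

row : List ℕ → ℕ → ℕ
row []       _       = 0
row (x ∷ _)  zero    = x
row (_ ∷ xs) (suc i) = row xs i

Cell : List ℕ → ℕ → ℕ → Set
Cell λ′ i j = j < row λ′ i

Adjacent : ℕ → ℕ → ℕ → ℕ → Set
Adjacent i j i′ j′ = (i′ ≡ i × j′ ≡ suc j) ⊎ (i′ ≡ suc i × j′ ≡ j)

AddDomino : List ℕ → List ℕ → Set
AddDomino μ ν =
  (∀ i j → Cell μ i j → Cell ν i j) ×
  Σ ℕ λ i → Σ ℕ λ j → Σ ℕ λ i′ → Σ ℕ λ j′ →
    Adjacent i j i′ j′ ×
    (Cell ν i j × (Cell μ i j → ⊥)) ×
    (Cell ν i′ j′ × (Cell μ i′ j′ → ⊥)) ×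
    (∀ a b → Cell ν a b → (Cell μ a b → ⊥) →
       (a ≡ i × b ≡ j) ⊎ (a ≡ i′ × b ≡ j′))

DominoStep : List ℕ → List ℕ → Set
DominoStep κ κ′ = AddDomino κ κ′ ⊎ AddDomino κ′ κ

AtMostTwoColumns : List ℕ → Set
AtMostTwoColumns λ′ = All (λ k → k ≤ 2) λ′

IsOscDomino2 : ℕ → List (List ℕ) → Set
IsOscDomino2 n seq =
  length seq ≡ suc (2 * n) ×
  head seq ≡ just [] ×
  last seq ≡ just [] ×
  All IsPartition seq ×
  All AtMostTwoColumns seq ×
  Linked DominoStep seq

O2n2 : ℕ → Set
O2n2 n = Σ (List (List ℕ)) (IsOscDomino2 n)

data Step : Set where
  U D H : Step

stepΔ : Step → ℤ
stepΔ U = + 1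
stepΔ D = ℤ.- (+ 1)
stepΔ H = + 0

height : List Step → ℤ
height []       = + 0
height (s ∷ ss) = stepΔ s ℤ.+ height ss

heightAt : List Step → ℕ → ℤ
heightAt p i = height (take i p)

IsDyck : ℕ → List Step → Set
IsDyck n p =
  length p ≡ 2 * n ×
  All (λ s → s ≡ U ⊎ s ≡ D) p ×
  (∀ i → i ≤ 2 * n → + 0 ℤ.≤ heightAt p i) ×
  height p ≡ + 0

-- dispersed Dyck path of length 2n: (1,0) steps only on the x-axis
IsDispersedDyck : ℕ → List Step → Set
IsDispersedDyck n p =
  length p ≡ 2 * n ×
  (∀ i → i ≤ 2 * n → + 0 ℤ.≤ heightAt p i) ×
  height p ≡ + 0 ×
  (∀ i → take (suc i) p ≡ take i p ++ (H ∷ []) → heightAt p i ≡ + 0)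

IsPacking : ℕ → List Step × List Step → Set
IsPacking n (d , e) =
  IsDyck n d × IsDispersedDyck n e ×
  (∀ i → i ≤ 2 * n → heightAt e i ℤ.≤ heightAt d i)

P2n : ℕ → Set
P2n n = Σ (List Step × List Step) (IsPacking n)

-- Bijection between subsets carved out by predicates, with equality
-- of the underlying data (proofs of the defining predicates are ignored).

Bijection : ∀ {A B : Set} {P : A → Set} {Q : B → Set} →
            Set
Bijection {A} {B} {P} {Q} =
  Σ (Σ A P → Σ B Q) λ f → Σ (Σ B Q → Σ A P) λ g →
    (∀ x → proj₁ (g (f x)) ≡ proj₁ x) ×
    (∀ y → proj₁ (f (g y)) ≡ proj₁ y)

module Submission where

open import Defs
open import Data.Nat using (ℕ; zero; suc; _+_; _*_; _∸_; _≤_; _<_; _≥_; z≤n; s≤s; z<s; s<s; pred; ⌊_/2⌋)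
open import Data.Nat.Properties
  using ( ≤-refl; ≤-trans; ≤-antisym; ≤-pred; <-trans; <-irrefl; ≤-<-trans; <-≤-trans; ≮⇒≥
        ; n≤1+n; n<1+n; m≤n⇒m≤1+n; m≤n⇒m<n∨m≡n; m≤n+m; m<n+m; n≮n; n≮0; m+n≮n; 1+n≰n
        ; 1+n≢n; m≢1+n+m; suc-injective; +-comm; +-identityʳ; +-suc; +-cancelʳ-≤
        ; m∸n+n≡m; m+n∸n≡m; +-∸-assoc)
open import Data.Integer as ℤ using (+_; +≤+)
open import Data.Integer.Properties as ℤ using ()
open import Data.List using (List; []; _∷_; length; head; last; take; map; zipWith; _++_)
open import Data.List.Properties
  using (length-map; head-map; last-map; map-∘; map-cong; map-id; map-id-local; take-[]; ∷-injective)
open import Data.List.Relation.Unary.All as All using (All; []; _∷_)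
open import Data.List.Relation.Unary.All.Properties using () renaming (map⁺ to All-map⁺)
open import Data.List.Relation.Unary.Linked as Linked using (Linked; []; [-]; _∷_)
open import Data.List.Relation.Unary.Linked.Properties using (Linked⇒All) renaming (map⁺ to Linked-map⁺)
open import Data.Maybe as Maybe using (just)
open import Data.Product using (Σ; _×_; _,_; proj₁; proj₂)
open import Data.Sum as Sum using (_⊎_; inj₁; inj₂)
open import Data.Empty using (⊥; ⊥-elim)
open import Function using (_∘_)
open import Function.Bundles using (_⇔_; mk⇔; Equivalence)
open import Function.Construct.Composition using (_⇔-∘_)
open import Relation.Nullary using (¬_)
open import Relation.Binary.PropositionalEquality
  using (_≡_; refl; sym; trans; cong; cong₂; subst; subst₂; module ≡-Reasoning)

-- A shape with at most two columns is determined by its two column lengths.  The shapes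
-- reachable from ∅ by dominoes correspond to states (d , v) ∈ ℕ², with d + v half the number
-- of cells, in such a way that adding a domino is exactly one of the moves
-- (d , v) → (d , v+1), (d , v+1) → (d+2 , v) and (d , 0) → (d+1 , 0).  An oscillating tableau
-- is therefore a walk of states from (0 , 0) back to (0 , 0).  Along the walk d + v changes by
-- ±1 and traces a Dyck path, while v changes by ±1 or stays put at 0 and traces a dispersed
-- Dyck path below it; conversely the two height sequences give back the walk as
-- (d , v) = (height D − height E , height E).

record InverseOn {A B : Set} (P : A → Set) (Q : B → Set) : Set where
  field
    to             : A → B
    from           : B → A
    to-preserves   : ∀ {a} → P a → Q (to a)
    from-preserves : ∀ {b} → Q b → P (from b)
    from∘to        : ∀ {a} → P a → from (to a) ≡ a
    to∘from        : ∀ {b} → Q b → to (from b) ≡ b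

inverseOn-∘ : ∀ {A B C : Set} {P : A → Set} {Q : B → Set} {R : C → Set} →
              InverseOn P Q → InverseOn Q R → InverseOn P R
inverseOn-∘ f g = record
  { to             = G.to ∘ F.to
  ; from           = F.from ∘ G.from
  ; to-preserves   = G.to-preserves ∘ F.to-preserves
  ; from-preserves = F.from-preserves ∘ G.from-preserves
  ; from∘to        = λ p → trans (cong F.from (G.from∘to (F.to-preserves p))) (F.from∘to p)
  ; to∘from        = λ r → trans (cong G.to (F.to∘from (G.from-preserves r))) (G.to∘from r)
  }
  where
  module F = InverseOn f
  module G = InverseOn g

inverseOn⇒bijection : ∀ {A B : Set} {P : A → Set} {Q : B → Set} →
                      InverseOn P Q → Bijection {P = P} {Q = Q}
inverseOn⇒bijection f =
  (λ (a , p) → to a , to-preserves p) , (λ (b , q) → from b , from-preserves q) ,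
  (λ (a , p) → from∘to p) , (λ (b , q) → to∘from q)
  where open InverseOn f

-- Shapes with at most two columns

-- The shape with columns of lengths P and Q; meaningful only when Q ≤ P.
twoColumn : ℕ → ℕ → List ℕ
twoColumn zero    _       = []
twoColumn (suc P) zero    = 1 ∷ twoColumn P 0
twoColumn (suc P) (suc Q) = 2 ∷ twoColumn P Q

columnLength : ℕ → ℕ → ℕ → ℕ
columnLength P Q zero          = P
columnLength P Q (suc zero)    = Q
columnLength P Q (suc (suc _)) = 0

secondColumnLength : List ℕ → ℕ
secondColumnLength []                = 0
secondColumnLength (suc (suc _) ∷ s) = suc (secondColumnLength s)
secondColumnLength (_ ∷ s)           = secondColumnLength s

suc-<-columnLength : ∀ x P Q c → x < columnLength P (pred Q) c ⇔ suc x < columnLength (suc P) Q c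
suc-<-columnLength x P Q       zero          = mk⇔ s≤s ≤-pred
suc-<-columnLength x P zero    (suc zero)    = mk⇔ (λ ()) (λ ())
suc-<-columnLength x P (suc Q) (suc zero)    = mk⇔ s≤s ≤-pred
suc-<-columnLength x P Q       (suc (suc c)) = mk⇔ (λ ()) (λ ())

cell-twoColumn : ∀ {P Q} → Q ≤ P → ∀ x c → Cell (twoColumn P Q) x c ⇔ x < columnLength P Q c
cell-twoColumn {zero}          z≤n     x       zero          = mk⇔ (λ ()) (λ ())
cell-twoColumn {zero}          z≤n     x       (suc zero)    = mk⇔ (λ ()) (λ ())
cell-twoColumn {zero}          z≤n     x       (suc (suc c)) = mk⇔ (λ ()) (λ ())
cell-twoColumn {suc P} {zero}  _       zero    zero          = mk⇔ (λ _ → z<s) (λ _ → z<s)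
cell-twoColumn {suc P} {zero}  _       zero    (suc zero)    = mk⇔ (λ { (s≤s ()) }) (λ ())
cell-twoColumn {suc P} {zero}  _       zero    (suc (suc c)) = mk⇔ (λ { (s≤s ()) }) (λ ())
cell-twoColumn {suc P} {suc Q} _       zero    zero          = mk⇔ (λ _ → z<s) (λ _ → z<s)
cell-twoColumn {suc P} {suc Q} _       zero    (suc zero)    = mk⇔ (λ _ → z<s) (λ _ → s<s z<s)
cell-twoColumn {suc P} {suc Q} _       zero    (suc (suc c)) = mk⇔ (λ { (s≤s (s≤s ())) }) (λ ())
cell-twoColumn {suc P} {zero}  z≤n     (suc x) c =
  suc-<-columnLength x P 0 c ⇔-∘ cell-twoColumn z≤n x c
cell-twoColumn {suc P} {suc Q} (s≤s q) (suc x) c =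
  suc-<-columnLength x P (suc Q) c ⇔-∘ cell-twoColumn q x c

length-twoColumn : ∀ P Q → length (twoColumn P Q) ≡ P
length-twoColumn zero    _       = refl
length-twoColumn (suc P) zero    = cong suc (length-twoColumn P 0)
length-twoColumn (suc P) (suc Q) = cong suc (length-twoColumn P Q)

secondColumnLength-twoColumn : ∀ {P Q} → Q ≤ P → secondColumnLength (twoColumn P Q) ≡ Q
secondColumnLength-twoColumn {zero}  z≤n     = refl
secondColumnLength-twoColumn {suc P} z≤n     = secondColumnLength-twoColumn {P} z≤n
secondColumnLength-twoColumn         (s≤s q) = cong suc (secondColumnLength-twoColumn q)

twoColumn-atMostTwoColumns : ∀ P Q → AtMostTwoColumns (twoColumn P Q)
twoColumn-atMostTwoColumns zero    _       = []
twoColumn-atMostTwoColumns (suc P) zero    = s≤s z≤n ∷ twoColumn-atMostTwoColumns P 0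
twoColumn-atMostTwoColumns (suc P) (suc Q) = s≤s (s≤s z≤n) ∷ twoColumn-atMostTwoColumns P Q

twoColumn-linked : ∀ P Q → Linked _≥_ (twoColumn P Q)
twoColumn-linked zero                zero          = []
twoColumn-linked zero                (suc Q)       = []
twoColumn-linked (suc zero)          zero          = [-]
twoColumn-linked (suc zero)          (suc Q)       = [-]
twoColumn-linked (suc (suc P))       zero          = ≤-refl ∷ twoColumn-linked (suc P) 0
twoColumn-linked (suc (suc P))       (suc zero)    = s≤s z≤n ∷ twoColumn-linked (suc P) 0
twoColumn-linked (suc (suc P))       (suc (suc Q)) = ≤-refl ∷ twoColumn-linked (suc P) (suc Q)

twoColumn-isPartition : ∀ P Q → IsPartition (twoColumn P Q)
twoColumn-isPartition P Q = twoColumn-linked P Q , positive P Q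
  where
  positive : ∀ P Q → All (0 <_) (twoColumn P Q)
  positive zero    _       = []
  positive (suc P) zero    = z<s ∷ positive P 0
  positive (suc P) (suc Q) = z<s ∷ positive P Q

secondColumnLength≤length : ∀ s → secondColumnLength s ≤ length s
secondColumnLength≤length []                = z≤n
secondColumnLength≤length (zero ∷ s)        = m≤n⇒m≤1+n (secondColumnLength≤length s)
secondColumnLength≤length (suc zero ∷ s)    = m≤n⇒m≤1+n (secondColumnLength≤length s)
secondColumnLength≤length (suc (suc _) ∷ s) = s≤s (secondColumnLength≤length s)

secondColumnLength-≤1 : ∀ {s} → All (_≤ 1) s → secondColumnLength s ≡ 0
secondColumnLength-≤1 []                   = refl
secondColumnLength-≤1 {zero ∷ _}     (_ ∷ ps) = secondColumnLength-≤1 ps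
secondColumnLength-≤1 {suc zero ∷ _} (_ ∷ ps) = secondColumnLength-≤1 ps
secondColumnLength-≤1 {suc (suc _) ∷ _} (s≤s () ∷ _)

twoColumn-complete : ∀ {s} → IsPartition s → AtMostTwoColumns s →
                     s ≡ twoColumn (length s) (secondColumnLength s)
twoColumn-complete {[]}                 _              _          = refl
twoColumn-complete {zero ∷ _}           (_ , () ∷ _)   _
twoColumn-complete {suc zero ∷ r}       (l , _ ∷ pos)  (_ ∷ ams)  =
  trans (cong (1 ∷_) (trans (twoColumn-complete (Linked.tail l , pos) ams)
                            (cong (twoColumn (length r)) no-second-column)))
        (cong (twoColumn (suc (length r))) (sym no-second-column))
  where
  no-second-column : secondColumnLength r ≡ 0
  no-second-column = secondColumnLength-≤1 (All.tail (Linked⇒All (λ p q → ≤-trans q p) ≤-refl l))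
twoColumn-complete {suc (suc zero) ∷ r} (l , _ ∷ pos)  (_ ∷ ams)  =
  cong (2 ∷_) (twoColumn-complete (Linked.tail l , pos) ams)
twoColumn-complete {suc (suc (suc _)) ∷ _} _ (s≤s (s≤s ()) ∷ _)

-- Domino moves between two-column shapes

data DominoMove : ℕ → ℕ → ℕ → ℕ → Set where
  vertical₁  : ∀ {P Q} → Q ≤ P → DominoMove P Q (2 + P) Q
  vertical₂  : ∀ {P Q} → 2 + Q ≤ P → DominoMove P Q P (2 + Q)
  horizontal : ∀ {P} → DominoMove P P (suc P) (suc P)

between-one : ∀ {x a} → x < suc a → ¬ x < a → x ≡ a
between-one x<1+a x≮a = ≤-antisym (≤-pred x<1+a) (≮⇒≥ x≮a)

between-two : ∀ {x a} → x < 2 + a → ¬ x < a → x ≡ a ⊎ x ≡ suc a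
between-two x<2+a x≮a with m≤n⇒m<n∨m≡n (≤-pred x<2+a)
... | inj₁ x<1+a = inj₁ (between-one x<1+a x≮a)
... | inj₂ x≡1+a = inj₂ x≡1+a

columns⇒AddDomino : ∀ {P Q P′ Q′ i j i′ j′} → Q ≤ P → Q′ ≤ P′ →
  (∀ c → columnLength P Q c ≤ columnLength P′ Q′ c) →
  Adjacent i j i′ j′ →
  i < columnLength P′ Q′ j → ¬ i < columnLength P Q j →
  i′ < columnLength P′ Q′ j′ → ¬ i′ < columnLength P Q j′ →
  (∀ {x} c → x < columnLength P′ Q′ c → ¬ x < columnLength P Q c → (x ≡ i × c ≡ j) ⊎ (x ≡ i′ × c ≡ j′)) →
  AddDomino (twoColumn P Q) (twoColumn P′ Q′)
columns⇒AddDomino {i = i} {j} {i′} {j′} q≤p q′≤p′ mono adj i-new i-old i′-new i′-old only =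
  (λ x c → from′ c ∘ (λ x<a → <-≤-trans x<a (mono c)) ∘ to c) ,
  i , j , i′ , j′ , adj ,
  (from′ j i-new , i-old ∘ to j) , (from′ j′ i′-new , i′-old ∘ to j′) ,
  (λ x c x∈ν x∉μ → only c (to′ c x∈ν) (x∉μ ∘ from c))
  where
  to    = λ {x} c → Equivalence.to   (cell-twoColumn q≤p x c)
  from  = λ {x} c → Equivalence.from (cell-twoColumn q≤p x c)
  to′   = λ {x} c → Equivalence.to   (cell-twoColumn q′≤p′ x c)
  from′ = λ {x} c → Equivalence.from (cell-twoColumn q′≤p′ x c)

DominoMove⇒AddDomino : ∀ {P Q P′ Q′} → Q ≤ P → DominoMove P Q P′ Q′ →
                       AddDomino (twoColumn P Q) (twoColumn P′ Q′)
DominoMove⇒AddDomino {P} {Q} _ (vertical₁ q≤p) =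
  columns⇒AddDomino q≤p (≤-trans q≤p (m≤n+m P 2)) mono (inj₂ (refl , refl))
    (m<n+m P z<s) (n≮n P) ≤-refl (m+n≮n 1 P) only
  where
  mono : ∀ c → columnLength P Q c ≤ columnLength (2 + P) Q c
  mono zero          = m≤n+m P 2
  mono (suc zero)    = ≤-refl
  mono (suc (suc c)) = z≤n
  only : ∀ {x} c → x < columnLength (2 + P) Q c → ¬ x < columnLength P Q c →
         (x ≡ P × c ≡ 0) ⊎ (x ≡ suc P × c ≡ 0)
  only zero          x<b x≮a = Sum.map (_, refl) (_, refl) (between-two x<b x≮a)
  only (suc zero)    x<b x≮a = ⊥-elim (x≮a x<b)
  only (suc (suc c)) ()
DominoMove⇒AddDomino {P} {Q} _ (vertical₂ 2+q≤p) =
  columns⇒AddDomino (≤-trans (m≤n+m Q 2) 2+q≤p) 2+q≤p mono (inj₂ (refl , refl))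
    (m<n+m Q z<s) (n≮n Q) ≤-refl (m+n≮n 1 Q) only
  where
  mono : ∀ c → columnLength P Q c ≤ columnLength P (2 + Q) c
  mono zero          = ≤-refl
  mono (suc zero)    = m≤n+m Q 2
  mono (suc (suc c)) = z≤n
  only : ∀ {x} c → x < columnLength P (2 + Q) c → ¬ x < columnLength P Q c →
         (x ≡ Q × c ≡ 1) ⊎ (x ≡ suc Q × c ≡ 1)
  only zero          x<b x≮a = ⊥-elim (x≮a x<b)
  only (suc zero)    x<b x≮a = Sum.map (_, refl) (_, refl) (between-two x<b x≮a)
  only (suc (suc c)) ()
DominoMove⇒AddDomino {P} _ horizontal =
  columns⇒AddDomino ≤-refl ≤-refl mono (inj₁ (refl , refl))
    ≤-refl (n≮n P) ≤-refl (n≮n P) only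
  where
  mono : ∀ c → columnLength P P c ≤ columnLength (suc P) (suc P) c
  mono zero          = n≤1+n P
  mono (suc zero)    = n≤1+n P
  mono (suc (suc c)) = z≤n
  only : ∀ {x} c → x < columnLength (suc P) (suc P) c → ¬ x < columnLength P P c →
         (x ≡ P × c ≡ 0) ⊎ (x ≡ P × c ≡ 1)
  only zero          x<b x≮a = inj₁ (between-one x<b x≮a , refl)
  only (suc zero)    x<b x≮a = inj₂ (between-one x<b x≮a , refl)
  only (suc (suc c)) ()

Grows : ℕ → ℕ → (ℕ → Set) → Set
Grows a b New = (∀ {x} → x < a → x < b) × (∀ {x} → x < b → ¬ x < a → New x)

grows-map : ∀ {a b} {New New′ : ℕ → Set} → (∀ {x} → New x → New′ x) → Grows a b New → Grows a b New′
grows-map f (sub , new) = sub , (λ x<b x≮a → f (new x<b x≮a))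

grows-by-none : ∀ {a b} → Grows a b (λ _ → ⊥) → a ≡ b
grows-by-none (sub , new) =
  ≤-antisym (≮⇒≥ (λ b<a → <-irrefl refl (sub b<a))) (≮⇒≥ (λ a<b → new a<b (n≮n _)))

grows-by-one : ∀ {a b i} → Grows a b (_≡ i) → i < b → ¬ i < a → a ≡ i × b ≡ suc a
grows-by-one {a} (sub , new) i<b i≮a = a≡i , ≤-antisym (≮⇒≥ a+1≮b) a<b
  where
  a<b = ≤-<-trans (≮⇒≥ i≮a) i<b
  a≡i = new a<b (n≮n a)
  a+1≮b : ¬ suc a < _
  a+1≮b a+1<b = 1+n≢n (trans (new a+1<b (m+n≮n 1 a)) (sym a≡i))

grows-by-two : ∀ {a b i} → Grows a b (λ x → x ≡ i ⊎ x ≡ suc i) → suc i < b → ¬ i < a →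
               a ≡ i × b ≡ 2 + a
grows-by-two {a} {b} {i} (sub , new) i+1<b i≮a = a≡i , ≤-antisym (≮⇒≥ a+2≮b) 2+a≤b
  where
  a≤i = ≮⇒≥ i≮a
  a≡i : a ≡ i
  a≡i with new (≤-<-trans a≤i (<-trans (n<1+n i) i+1<b)) (n≮n a)
  ... | inj₁ a≡i   = a≡i
  ... | inj₂ a≡1+i = ⊥-elim (1+n≰n (subst (_≤ i) a≡1+i a≤i))
  2+a≤b : 2 + a ≤ b
  2+a≤b = subst (λ y → 2 + y ≤ b) (sym a≡i) i+1<b
  a+2≮b : ¬ 2 + a < b
  a+2≮b a+2<b with new a+2<b (m+n≮n 2 a)
  ... | inj₁ a+2≡i   = m≢1+n+m a (sym (trans a+2≡i (sym a≡i)))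
  ... | inj₂ a+2≡1+i = 1+n≢n (suc-injective (trans a+2≡1+i (cong suc (sym a≡i))))

columns-grow : ∀ {P Q P′ Q′} {New : ℕ → ℕ → Set} → Q ≤ P → Q′ ≤ P′ →
  (∀ x c → Cell (twoColumn P Q) x c → Cell (twoColumn P′ Q′) x c) →
  (∀ x c → Cell (twoColumn P′ Q′) x c → ¬ Cell (twoColumn P Q) x c → New x c) →
  ∀ c → Grows (columnLength P Q c) (columnLength P′ Q′ c) (λ x → New x c)
columns-grow q≤p q′≤p′ sub only c =
  (λ x<a → Equivalence.to (cell′ _) (sub _ c (Equivalence.from (cell _) x<a))) ,
  (λ x<b x≮a → only _ c (Equivalence.from (cell′ _) x<b) (x≮a ∘ Equivalence.to (cell _)))
  where
  cell  = λ x → cell-twoColumn q≤p x c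
  cell′ = λ x → cell-twoColumn q′≤p′ x c

new-cell : ∀ {P Q P′ Q′ x c} → Q ≤ P → Q′ ≤ P′ →
  Cell (twoColumn P′ Q′) x c × ¬ Cell (twoColumn P Q) x c →
  x < columnLength P′ Q′ c × ¬ x < columnLength P Q c
new-cell {x = x} {c} q≤p q′≤p′ (x∈ν , x∉μ) =
  Equivalence.to (cell-twoColumn q′≤p′ x c) x∈ν , x∉μ ∘ Equivalence.from (cell-twoColumn q≤p x c)

AddDomino⇒DominoMove : ∀ {P Q P′ Q′} → Q ≤ P → Q′ ≤ P′ →
  AddDomino (twoColumn P Q) (twoColumn P′ Q′) → DominoMove P Q P′ Q′
AddDomino⇒DominoMove q≤p q′≤p′ (sub , i , zero , _ , _ , inj₁ (refl , refl) , c₁ , c₂ , only)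
  with grows-by-one (grows-map (λ { (inj₁ (e , _)) → e ; (inj₂ (_ , ())) }) (grows 0))
                    (proj₁ (new-cell q≤p q′≤p′ c₁)) (proj₂ (new-cell q≤p q′≤p′ c₁))
     | grows-by-one (grows-map (λ { (inj₁ (_ , ())) ; (inj₂ (e , _)) → e }) (grows 1))
                    (proj₁ (new-cell q≤p q′≤p′ c₂)) (proj₂ (new-cell q≤p q′≤p′ c₂))
  where grows = columns-grow q≤p q′≤p′ sub only
... | refl , refl | refl , refl = horizontal
AddDomino⇒DominoMove q≤p q′≤p′ (sub , i , suc j , _ , _ , inj₁ (refl , refl) , c₁ , c₂ , only) =
  ⊥-elim (n≮0 (proj₁ (new-cell q≤p q′≤p′ c₂)))
AddDomino⇒DominoMove q≤p q′≤p′ (sub , i , zero , _ , _ , inj₂ (refl , refl) , c₁ , c₂ , only)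
  with grows-by-two (grows-map (λ { (inj₁ (e , _)) → inj₁ e ; (inj₂ (e , _)) → inj₂ e }) (grows 0))
                    (proj₁ (new-cell q≤p q′≤p′ c₂)) (proj₂ (new-cell q≤p q′≤p′ c₁))
     | grows-by-none (grows-map (λ { (inj₁ (_ , ())) ; (inj₂ (_ , ())) }) (grows 1))
  where grows = columns-grow q≤p q′≤p′ sub only
... | refl , refl | refl = vertical₁ q≤p
AddDomino⇒DominoMove q≤p q′≤p′ (sub , i , suc zero , _ , _ , inj₂ (refl , refl) , c₁ , c₂ , only)
  with grows-by-none (grows-map (λ { (inj₁ (_ , ())) ; (inj₂ (_ , ())) }) (grows 0))
     | grows-by-two (grows-map (λ { (inj₁ (e , _)) → inj₁ e ; (inj₂ (e , _)) → inj₂ e }) (grows 1))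
                    (proj₁ (new-cell q≤p q′≤p′ c₂)) (proj₂ (new-cell q≤p q′≤p′ c₁))
  where grows = columns-grow q≤p q′≤p′ sub only
... | refl | refl , refl = vertical₂ q′≤p′
AddDomino⇒DominoMove q≤p q′≤p′ (sub , i , suc (suc j) , _ , _ , inj₂ (refl , refl) , c₁ , c₂ , only) =
  ⊥-elim (n≮0 (proj₁ (new-cell q≤p q′≤p′ c₁)))

State : Set
State = ℕ × ℕ

data _⟶_ : State → State → Set where
  rise : ∀ d v → (d , v) ⟶ (d , suc v)
  fall : ∀ d v → (d , suc v) ⟶ (2 + d , v)
  flat : ∀ d → (d , 0) ⟶ (suc d , 0)

_⟷_ : State → State → Set
x ⟷ y = x ⟶ y ⊎ y ⟶ x

shift : State → State
shift (d , v) = (2 + d , v)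

double : ℕ → ℕ
double zero    = zero
double (suc n) = 2 + double n

-- Column lengths of the shape of a state: in row notation the shape of (2m , 0) is 2^(2m),
-- that of (2m , v+1) is 2^(2m+1) 1^(2v), and that of (2m+1 , v) is 2^(2m) 1^(2v+2).
col₁ col₂ : State → ℕ
col₁ (zero , zero)     = 0
col₁ (zero , suc v)    = suc (double v)
col₁ (suc zero , v)    = 2 + double v
col₁ (suc (suc d) , v) = 2 + col₁ (d , v)

col₂ (zero , zero)     = 0
col₂ (zero , suc v)    = 1
col₂ (suc zero , v)    = 0
col₂ (suc (suc d) , v) = 2 + col₂ (d , v)

col₂≤col₁ : ∀ x → col₂ x ≤ col₁ x
col₂≤col₁ (zero , zero)     = z≤n
col₂≤col₁ (zero , suc v)    = s≤s z≤n
col₂≤col₁ (suc zero , v)    = z≤n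
col₂≤col₁ (suc (suc d) , v) = s≤s (s≤s (col₂≤col₁ (d , v)))

shapeOf : State → List ℕ
shapeOf x = twoColumn (col₁ x) (col₂ x)

-- Inverse of (col₁ , col₂) on its image; every other pair is sent to (0 , 0).
stateOf : ℕ → ℕ → State
stateOf zero          zero          = (0 , 0)
stateOf (suc P)       zero          = (1 , ⌊ P /2⌋)
stateOf (suc P)       (suc zero)    = (0 , suc ⌊ P /2⌋)
stateOf (suc (suc P)) (suc (suc Q)) = shift (stateOf P Q)
stateOf _             _             = (0 , 0)

⌊double/2⌋ : ∀ n → ⌊ double n /2⌋ ≡ n
⌊double/2⌋ zero    = refl
⌊double/2⌋ (suc n) = cong suc (⌊double/2⌋ n)

⌊1+double/2⌋ : ∀ n → ⌊ suc (double n) /2⌋ ≡ n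
⌊1+double/2⌋ zero    = refl
⌊1+double/2⌋ (suc n) = cong suc (⌊1+double/2⌋ n)

stateOf-col : ∀ x → stateOf (col₁ x) (col₂ x) ≡ x
stateOf-col (zero , zero)     = refl
stateOf-col (zero , suc v)    = cong (λ w → (0 , suc w)) (⌊double/2⌋ v)
stateOf-col (suc zero , v)    = cong (1 ,_) (⌊1+double/2⌋ v)
stateOf-col (suc (suc d) , v) = cong shift (stateOf-col (d , v))

stateOfShape : List ℕ → State
stateOfShape s = stateOf (length s) (secondColumnLength s)

stateOfShape-shapeOf : ∀ x → stateOfShape (shapeOf x) ≡ x
stateOfShape-shapeOf x =
  trans (cong₂ stateOf (length-twoColumn (col₁ x) (col₂ x)) (secondColumnLength-twoColumn (col₂≤col₁ x)))
        (stateOf-col x)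

DominoMove-shift : ∀ {P Q P′ Q′} → DominoMove P Q P′ Q′ → DominoMove (2 + P) (2 + Q) (2 + P′) (2 + Q′)
DominoMove-shift (vertical₁ q≤p)   = vertical₁ (s≤s (s≤s q≤p))
DominoMove-shift (vertical₂ 2+q≤p) = vertical₂ (s≤s (s≤s 2+q≤p))
DominoMove-shift horizontal        = horizontal

⟶-shift : ∀ {x y} → x ⟶ y → shift x ⟶ shift y
⟶-shift (rise d v) = rise (2 + d) v
⟶-shift (fall d v) = fall (2 + d) v
⟶-shift (flat d)   = flat (2 + d)

⟶⇒DominoMove : ∀ {x y} → x ⟶ y → DominoMove (col₁ x) (col₂ x) (col₁ y) (col₂ y)
⟶⇒DominoMove (rise zero zero)       = horizontal
⟶⇒DominoMove (rise zero (suc v))    = vertical₁ (s≤s z≤n)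
⟶⇒DominoMove (rise (suc zero) v)    = vertical₁ z≤n
⟶⇒DominoMove (rise (suc (suc d)) v) = DominoMove-shift (⟶⇒DominoMove (rise d v))
⟶⇒DominoMove (fall zero zero)       = horizontal
⟶⇒DominoMove (fall zero (suc v))    = vertical₂ (s≤s (s≤s (s≤s z≤n)))
⟶⇒DominoMove (fall (suc zero) v)    = vertical₂ (s≤s (s≤s z≤n))
⟶⇒DominoMove (fall (suc (suc d)) v) = DominoMove-shift (⟶⇒DominoMove (fall d v))
⟶⇒DominoMove (flat zero)            = vertical₁ z≤n
⟶⇒DominoMove (flat (suc zero))      = vertical₂ (s≤s (s≤s z≤n))
⟶⇒DominoMove (flat (suc (suc d)))   = DominoMove-shift (⟶⇒DominoMove (flat d))

⟷⇒DominoStep : ∀ {x y} → x ⟷ y → DominoStep (shapeOf x) (shapeOf y)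
⟷⇒DominoStep {x} (inj₁ x⟶y)     = inj₁ (DominoMove⇒AddDomino (col₂≤col₁ x) (⟶⇒DominoMove x⟶y))
⟷⇒DominoStep {y = y} (inj₂ y⟶x) = inj₂ (DominoMove⇒AddDomino (col₂≤col₁ y) (⟶⇒DominoMove y⟶x))

data UnshiftedMove : ℕ → ℕ → ℕ → ℕ → Set where
  unshifted : ∀ {P Q P′ Q′} → DominoMove P Q P′ Q′ → UnshiftedMove (2 + P) (2 + Q) (2 + P′) (2 + Q′)

unshift-source : ∀ {P Q P′ Q′} → DominoMove (2 + P) (2 + Q) P′ Q′ → UnshiftedMove (2 + P) (2 + Q) P′ Q′
unshift-source (vertical₁ (s≤s (s≤s q≤p)))   = unshifted (vertical₁ q≤p)
unshift-source (vertical₂ (s≤s (s≤s 2+q≤p))) = unshifted (vertical₂ 2+q≤p)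
unshift-source horizontal                    = unshifted horizontal

unshift-target : ∀ {P Q P′ Q′} → DominoMove P Q (4 + P′) (4 + Q′) → UnshiftedMove P Q (4 + P′) (4 + Q′)
unshift-target (vertical₁ (s≤s (s≤s q≤p)))   = unshifted (vertical₁ q≤p)
unshift-target (vertical₂ (s≤s (s≤s 2+q≤p))) = unshifted (vertical₂ 2+q≤p)
unshift-target horizontal                    = unshifted horizontal

Successor : State → ℕ → ℕ → Set
Successor x P′ Q′ = Σ State λ y → col₁ y ≡ P′ × col₂ y ≡ Q′ × x ⟶ y

Predecessor : ℕ → ℕ → State → Set
Predecessor P Q y = Σ State λ x → col₁ x ≡ P × col₂ x ≡ Q × x ⟶ y

successor : ∀ {x y} → x ⟶ y → Successor x (col₁ y) (col₂ y)
successor x⟶y = _ , refl , refl , x⟶y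

predecessor : ∀ {x y} → x ⟶ y → Predecessor (col₁ x) (col₂ x) y
predecessor x⟶y = _ , refl , refl , x⟶y

successor-shift : ∀ {x P Q} → Successor x P Q → Successor (shift x) (2 + P) (2 + Q)
successor-shift (y , refl , refl , x⟶y) = shift y , refl , refl , ⟶-shift x⟶y

predecessor-shift : ∀ {y P Q} → Predecessor P Q y → Predecessor (2 + P) (2 + Q) (shift y)
predecessor-shift (x , refl , refl , x⟶y) = shift x , refl , refl , ⟶-shift x⟶y

outgoing : ∀ d v {P′ Q′} → DominoMove (col₁ (d , v)) (col₂ (d , v)) P′ Q′ → Successor (d , v) P′ Q′
outgoing zero          zero          (vertical₁ _) = successor (flat 0)
outgoing zero          zero          horizontal    = successor (rise 0 0)
outgoing zero          (suc zero)    (vertical₁ _) = successor (rise 0 1)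
outgoing zero          (suc zero)    horizontal    = successor (fall 0 0)
outgoing zero          (suc zero)    (vertical₂ (s≤s ()))
outgoing zero          (suc (suc w)) (vertical₁ _) = successor (rise 0 (2 + w))
outgoing zero          (suc (suc w)) (vertical₂ _) = successor (fall 0 (suc w))
outgoing (suc zero)    v             (vertical₁ _) = successor (rise 1 v)
outgoing (suc zero)    zero          (vertical₂ _) = successor (flat 1)
outgoing (suc zero)    (suc w)       (vertical₂ _) = successor (fall 1 w)
outgoing (suc (suc d)) v             move with unshift-source move
... | unshifted move′ = successor-shift (outgoing d v move′)

incoming : ∀ d v {P Q} → DominoMove P Q (col₁ (d , v)) (col₂ (d , v)) → Predecessor P Q (d , v)
incoming zero                      (suc zero)    horizontal    = predecessor (rise 0 0)
incoming zero                      (suc (suc w)) (vertical₁ _) = predecessor (rise 0 (suc w))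
incoming (suc zero)                zero          (vertical₁ _) = predecessor (flat 0)
incoming (suc zero)                (suc w)       (vertical₁ _) = predecessor (rise 1 w)
incoming (suc (suc zero))          zero          (vertical₂ _) = predecessor (flat 1)
incoming (suc (suc zero))          zero          horizontal    = predecessor (fall 0 0)
incoming (suc (suc zero))          (suc zero)    (vertical₁ (s≤s ()))
incoming (suc (suc zero))          (suc zero)    (vertical₂ _) = predecessor (fall 0 1)
incoming (suc (suc zero))          (suc zero)    horizontal    = predecessor (rise 2 0)
incoming (suc (suc zero))          (suc (suc w)) (vertical₁ _) = predecessor (rise 2 (suc w))
incoming (suc (suc zero))          (suc (suc w)) (vertical₂ _) = predecessor (fall 0 (2 + w))
incoming (suc (suc (suc zero)))    zero          (vertical₁ _) = predecessor (flat 2)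
incoming (suc (suc (suc zero)))    (suc w)       (vertical₁ _) = predecessor (rise 3 w)
incoming (suc (suc (suc zero)))    v             (vertical₂ _) = predecessor (fall 1 v)
incoming (suc (suc (suc (suc d)))) v             move with unshift-target move
... | unshifted move′ = predecessor-shift (incoming (2 + d) v move′)

-- Oscillating tableaux as walks of states

Realised : List ℕ → Set
Realised s = shapeOf (stateOfShape s) ≡ s

shapeOf-realised : ∀ x → Realised (shapeOf x)
shapeOf-realised x = cong shapeOf (stateOfShape-shapeOf x)

DominoStep⇒⟷ : ∀ {x s′} → DominoStep (shapeOf x) s′ → IsPartition s′ → AtMostTwoColumns s′ →
               Σ State λ y → shapeOf y ≡ s′ × x ⟷ y
DominoStep⇒⟷ {x@(d , v)} {s′} step part cols = lift step
  where
  s′≡ : s′ ≡ twoColumn (length s′) (secondColumnLength s′)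
  s′≡ = twoColumn-complete part cols
  q′≤p′ = secondColumnLength≤length s′
  shape≡ : ∀ {y} → col₁ y ≡ length s′ → col₂ y ≡ secondColumnLength s′ → shapeOf y ≡ s′
  shape≡ e₁ e₂ = trans (cong₂ twoColumn e₁ e₂) (sym s′≡)
  lift : DominoStep (shapeOf x) s′ → Σ State λ y → shapeOf y ≡ s′ × x ⟷ y
  lift (inj₁ add)
    with outgoing d v (AddDomino⇒DominoMove (col₂≤col₁ x) q′≤p′
                                            (subst (AddDomino (shapeOf x)) s′≡ add))
  ... | y , e₁ , e₂ , x⟶y = y , shape≡ {y} e₁ e₂ , inj₁ x⟶y
  lift (inj₂ del)
    with incoming d v (AddDomino⇒DominoMove q′≤p′ (col₂≤col₁ x)
                                            (subst (λ t → AddDomino t (shapeOf x)) s′≡ del))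
  ... | y , e₁ , e₂ , y⟶x = y , shape≡ {y} e₁ e₂ , inj₂ y⟶x

dominoChain⇒walk : ∀ {s ss} → Realised s → Linked DominoStep (s ∷ ss) →
                   All IsPartition ss → All AtMostTwoColumns ss →
                   All Realised (s ∷ ss) × Linked _⟷_ (map stateOfShape (s ∷ ss))
dominoChain⇒walk r [-] [] [] = r ∷ [] , [-]
dominoChain⇒walk {s} {s′ ∷ _} r (step ∷ steps) (part ∷ parts) (cols ∷ colss)
  with DominoStep⇒⟷ {stateOfShape s} (subst (λ t → DominoStep t s′) (sym r) step) part cols
... | y , refl , x⟷y with dominoChain⇒walk (shapeOf-realised y) steps parts colss
...   | rs , walk = r ∷ rs , subst (stateOfShape s ⟷_) (sym (stateOfShape-shapeOf y)) x⟷y ∷ walk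

IsStateWalk : ℕ → List State → Set
IsStateWalk n xs =
  length xs ≡ suc (2 * n) × head xs ≡ just (0 , 0) × last xs ≡ just (0 , 0) × Linked _⟷_ xs

oscillating⇒walk : ∀ {n seq} → IsOscDomino2 n seq →
                   All Realised seq × Linked _⟷_ (map stateOfShape seq)
oscillating⇒walk {seq = []}     (_ , () , _)
oscillating⇒walk {seq = s ∷ ss} (_ , refl , _ , parts , cols , steps) =
  dominoChain⇒walk refl steps (All.tail parts) (All.tail cols)

tableau⇔walk : ∀ n → InverseOn (IsOscDomino2 n) (IsStateWalk n)
tableau⇔walk n = record
  { to             = map stateOfShape
  ; from           = map shapeOf
  ; to-preserves   = to-preserves
  ; from-preserves = from-preserves
  ; from∘to        = λ {seq} tableau →
                       trans (sym (map-∘ seq)) (map-id-local (proj₁ (oscillating⇒walk {n} tableau)))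
  ; to∘from        = λ {xs} _ →
                       trans (sym (map-∘ xs)) (trans (map-cong stateOfShape-shapeOf xs) (map-id xs))
  }
  where
  to-preserves : ∀ {seq} → IsOscDomino2 n seq → IsStateWalk n (map stateOfShape seq)
  to-preserves {seq} tableau@(len , hd , lst , _) =
    trans (length-map stateOfShape seq) len ,
    trans (head-map seq) (cong (Maybe.map stateOfShape) hd) ,
    trans (last-map stateOfShape seq) (cong (Maybe.map stateOfShape) lst) ,
    proj₂ (oscillating⇒walk {n} tableau)

  from-preserves : ∀ {xs} → IsStateWalk n xs → IsOscDomino2 n (map shapeOf xs)
  from-preserves {xs} (len , hd , lst , walk) =
    trans (length-map shapeOf xs) len ,
    trans (head-map xs) (cong (Maybe.map shapeOf) hd) ,
    trans (last-map shapeOf xs) (cong (Maybe.map shapeOf) lst) ,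
    All-map⁺ (All.universal (λ x → twoColumn-isPartition (col₁ x) (col₂ x)) xs) ,
    All-map⁺ (All.universal (λ x → twoColumn-atMostTwoColumns (col₁ x) (col₂ x)) xs) ,
    Linked-map⁺ (Linked.map ⟷⇒DominoStep walk)

stepBetween : ℕ → ℕ → Step
stepBetween zero    zero    = H
stepBetween zero    (suc _) = U
stepBetween (suc _) zero    = D
stepBetween (suc a) (suc b) = stepBetween a b

pathThrough : List ℕ → List Step
pathThrough (a ∷ b ∷ hs) = stepBetween a b ∷ pathThrough (b ∷ hs)
pathThrough _            = []

-- Truncated at height 0; only applied to paths that stay nonnegative.
move : Step → ℕ → ℕ
move U h = suc h
move D h = pred h
move H h = h

heightsAfter : ℕ → List Step → List ℕ
heightsAfter h []      = []
heightsAfter h (s ∷ p) = move s h ∷ heightsAfter (move s h) p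

heights : ℕ → List Step → List ℕ
heights h p = h ∷ heightsAfter h p

-- Entry i of x ∷ xs, or its last entry once i runs past the end (as take i does on paths).
atOrLast : {A : Set} → A → List A → ℕ → A
atOrLast x []       _       = x
atOrLast x (y ∷ ys) zero    = x
atOrLast x (y ∷ ys) (suc i) = atOrLast y ys i

atOrLast-map : {A B : Set} (f : A → B) (x : A) (xs : List A) (i : ℕ) →
               atOrLast (f x) (map f xs) i ≡ f (atOrLast x xs i)
atOrLast-map f x []       i       = refl
atOrLast-map f x (y ∷ ys) zero    = refl
atOrLast-map f x (y ∷ ys) (suc i) = atOrLast-map f y ys i

Exact : ℕ → Step → Set
Exact h s = + h ℤ.+ stepΔ s ≡ + move s h

exact-+ : ∀ {h s} → Exact h s → ∀ X → + h ℤ.+ (stepΔ s ℤ.+ X) ≡ + move s h ℤ.+ X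
exact-+ {h} {s} exact X = begin
  + h ℤ.+ (stepΔ s ℤ.+ X)   ≡⟨ ℤ.+-assoc (+ h) (stepΔ s) X ⟨
  (+ h ℤ.+ stepΔ s) ℤ.+ X   ≡⟨ cong (ℤ._+ X) exact ⟩
  + move s h ℤ.+ X          ∎
  where open ≡-Reasoning

data Neighbour (Flat : ℕ → Set) : ℕ → ℕ → Set where
  up   : ∀ a → Neighbour Flat a (suc a)
  down : ∀ a → Neighbour Flat (suc a) a
  stay : ∀ {a} → Flat a → Neighbour Flat a a

stepBetween-up : ∀ a → stepBetween a (suc a) ≡ U
stepBetween-up zero    = refl
stepBetween-up (suc a) = stepBetween-up a

stepBetween-down : ∀ a → stepBetween (suc a) a ≡ D
stepBetween-down zero    = refl
stepBetween-down (suc a) = stepBetween-down a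

stepBetween-stay : ∀ a → stepBetween a a ≡ H
stepBetween-stay zero    = refl
stepBetween-stay (suc a) = stepBetween-stay a

module _ {Flat : ℕ → Set} where

  stepBetween-exact : ∀ {a b} → Neighbour Flat a b → Exact a (stepBetween a b)
  stepBetween-exact (up a)       rewrite stepBetween-up a   = cong +_ (+-comm a 1)
  stepBetween-exact (down a)     rewrite stepBetween-down a = refl
  stepBetween-exact (stay {a} _) rewrite stepBetween-stay a = cong +_ (+-identityʳ a)

  move-stepBetween : ∀ {a b} → Neighbour Flat a b → move (stepBetween a b) a ≡ b
  move-stepBetween (up a)       rewrite stepBetween-up a   = refl
  move-stepBetween (down a)     rewrite stepBetween-down a = refl
  move-stepBetween (stay {a} _) rewrite stepBetween-stay a = refl

  stepBetween-+ : ∀ {a b} → Neighbour Flat a b → ∀ X →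
                  + a ℤ.+ (stepΔ (stepBetween a b) ℤ.+ X) ≡ + b ℤ.+ X
  stepBetween-+ {a} {b} a~b X =
    trans (exact-+ {a} {stepBetween a b} (stepBetween-exact a~b) X)
          (cong (λ c → + c ℤ.+ X) (move-stepBetween a~b))

  height-take-pathThrough : ∀ {a hs} → Linked (Neighbour Flat) (a ∷ hs) → ∀ i →
    + a ℤ.+ height (take i (pathThrough (a ∷ hs))) ≡ + atOrLast a hs i
  height-take-pathThrough {a} {[]}     _            i rewrite take-[] {A = Step} i = ℤ.+-identityʳ (+ a)
  height-take-pathThrough {a} {b ∷ hs} _            zero    = ℤ.+-identityʳ (+ a)
  height-take-pathThrough {a} {b ∷ hs} (a~b ∷ rest) (suc i) =
    trans (stepBetween-+ a~b _) (height-take-pathThrough rest i)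

  height-pathThrough : ∀ {a hs z} → Linked (Neighbour Flat) (a ∷ hs) → last (a ∷ hs) ≡ just z →
    + a ℤ.+ height (pathThrough (a ∷ hs)) ≡ + z
  height-pathThrough {a} {[]}     _            refl = ℤ.+-identityʳ (+ a)
  height-pathThrough {a} {b ∷ hs} (a~b ∷ rest) lst  =
    trans (stepBetween-+ a~b _) (height-pathThrough rest lst)

  heights-pathThrough : ∀ {a hs} → Linked (Neighbour Flat) (a ∷ hs) →
                        heights a (pathThrough (a ∷ hs)) ≡ a ∷ hs
  heights-pathThrough {a} {[]}     _            = refl
  heights-pathThrough {a} {b ∷ hs} (a~b ∷ rest) =
    cong (a ∷_) (trans (cong (λ c → heights c (pathThrough (b ∷ hs))) (move-stepBetween a~b))
                       (heights-pathThrough rest))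

length-pathThrough : ∀ a hs → length (pathThrough (a ∷ hs)) ≡ length hs
length-pathThrough a []       = refl
length-pathThrough a (b ∷ hs) = cong suc (length-pathThrough b hs)

UpOrDown : Step → Set
UpOrDown s = s ≡ U ⊎ s ≡ D

pathThrough-upOrDown : ∀ {hs} → Linked (Neighbour (λ _ → ⊥)) hs → All UpOrDown (pathThrough hs)
pathThrough-upOrDown []            = []
pathThrough-upOrDown [-]           = []
pathThrough-upOrDown (up a ∷ rest)   = inj₁ (stepBetween-up a) ∷ pathThrough-upOrDown rest
pathThrough-upOrDown (down a ∷ rest) = inj₂ (stepBetween-down a) ∷ pathThrough-upOrDown rest

pathThrough-flat : ∀ {a hs} → Linked (Neighbour (_≡ 0)) (a ∷ hs) → ∀ i →
  take (suc i) (pathThrough (a ∷ hs)) ≡ take i (pathThrough (a ∷ hs)) ++ (H ∷ []) → atOrLast a hs i ≡ 0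
pathThrough-flat [-]             zero    ()
pathThrough-flat [-]             (suc i) ()
pathThrough-flat (up a ∷ _)      zero    e with trans (sym (stepBetween-up a)) (proj₁ (∷-injective e))
... | ()
pathThrough-flat (down a ∷ _)    zero    e with trans (sym (stepBetween-down a)) (proj₁ (∷-injective e))
... | ()
pathThrough-flat (stay a≡0 ∷ _)  zero    _ = a≡0
pathThrough-flat (_ ∷ rest)      (suc i) e = pathThrough-flat rest i (proj₂ (∷-injective e))

StaysNonNeg : ℕ → List Step → Set
StaysNonNeg h p = ∀ i → i ≤ length p → + 0 ℤ.≤ + h ℤ.+ height (take i p)

FlatOnlyOnAxis : ℕ → List Step → Set
FlatOnlyOnAxis k q = ∀ i → take (suc i) q ≡ take i q ++ (H ∷ []) → + k ℤ.+ height (take i q) ≡ + 0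

staysNonNeg⇒exact : ∀ {h s p} → StaysNonNeg h (s ∷ p) → Exact h s
staysNonNeg⇒exact {h}     {U} _        = cong +_ (+-comm h 1)
staysNonNeg⇒exact {h}     {H} _        = cong +_ (+-identityʳ h)
staysNonNeg⇒exact {suc h} {D} _        = refl
staysNonNeg⇒exact {zero}  {D} nonneg with nonneg 1 (s≤s z≤n)
... | ()

staysNonNeg-tail : ∀ {h s p} → StaysNonNeg h (s ∷ p) → StaysNonNeg (move s h) p
staysNonNeg-tail {h} {s} nonneg i i≤ =
  subst (+ 0 ℤ.≤_) (exact-+ {h} {s} (staysNonNeg⇒exact nonneg) _) (nonneg (suc i) (s≤s i≤))

flatOnlyOnAxis-tail : ∀ {k e q} → Exact k e → FlatOnlyOnAxis k (e ∷ q) → FlatOnlyOnAxis (move e k) q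
flatOnlyOnAxis-tail {k} {e} exact onAxis i step =
  trans (sym (exact-+ {k} {e} exact _)) (onAxis (suc i) (cong (e ∷_) step))

flatOnlyOnAxis-H : ∀ {k q} → FlatOnlyOnAxis k (H ∷ q) → k ≡ 0
flatOnlyOnAxis-H {k} onAxis = ℤ.+-injective (trans (sym (ℤ.+-identityʳ (+ k))) (onAxis 0 refl))

record Nested (h : ℕ) (p : List Step) (k : ℕ) (q : List Step) : Set where
  field
    same-length  : length p ≡ length q
    upper-nonneg : StaysNonNeg h p
    lower-nonneg : StaysNonNeg k q
    below        : ∀ i → i ≤ length p → + k ℤ.+ height (take i q) ℤ.≤ + h ℤ.+ height (take i p)

  starts-below : k ≤ h
  starts-below = +-cancelʳ-≤ 0 k h (ℤ.drop‿+≤+ (below 0 z≤n))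

nested-tail : ∀ {h d p k e q} → Nested h (d ∷ p) k (e ∷ q) → Nested (move d h) p (move e k) q
nested-tail {h} {d} {p} {k} {e} {q} nested = record
  { same-length  = suc-injective same-length
  ; upper-nonneg = staysNonNeg-tail upper-nonneg
  ; lower-nonneg = staysNonNeg-tail lower-nonneg
  ; below        = λ i i≤ → subst₂ ℤ._≤_ (exact-+ {k} {e} (staysNonNeg⇒exact lower-nonneg) _)
                                         (exact-+ {h} {d} (staysNonNeg⇒exact upper-nonneg) _)
                                         (below (suc i) (s≤s i≤))
  }
  where open Nested nested

stepBetween-move : ∀ {h s} → Exact h s → stepBetween h (move s h) ≡ s
stepBetween-move {h}     {U} _ = stepBetween-up h
stepBetween-move {suc h} {D} _ = stepBetween-down h
stepBetween-move {zero}  {D} ()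
stepBetween-move {h}     {H} _ = stepBetween-stay h

pathThrough-heights : ∀ {h p} → StaysNonNeg h p → pathThrough (heights h p) ≡ p
pathThrough-heights {h} {[]}    _      = refl
pathThrough-heights {h} {s ∷ p} nonneg =
  cong₂ _∷_ (stepBetween-move (staysNonNeg⇒exact nonneg)) (pathThrough-heights (staysNonNeg-tail nonneg))

length-heights : ∀ h p → length (heights h p) ≡ suc (length p)
length-heights h []      = refl
length-heights h (s ∷ p) = cong suc (length-heights (move s h) p)

last-heights : ∀ {h p z} → StaysNonNeg h p → + h ℤ.+ height p ≡ + z → last (heights h p) ≡ just z
last-heights {h} {[]}    _      end = cong just (ℤ.+-injective (trans (sym (ℤ.+-identityʳ (+ h))) end))
last-heights {h} {s ∷ p} nonneg end =
  last-heights (staysNonNeg-tail nonneg) (trans (sym (exact-+ {h} {s} (staysNonNeg⇒exact nonneg) _)) end)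

last-zipWith : ∀ {A B C : Set} (f : A → B → C) {xs ys a b} → length xs ≡ length ys →
               last xs ≡ just a → last ys ≡ just b → last (zipWith f xs ys) ≡ just (f a b)
last-zipWith f {[]}              {_}              _   ()
last-zipWith f {x ∷ []}          {y ∷ []}         _   refl refl = refl
last-zipWith f {x ∷ []}          {y ∷ _ ∷ _}      ()
last-zipWith f {x ∷ _ ∷ _}       {y ∷ []}         ()
last-zipWith f {x ∷ x′ ∷ xs}     {y ∷ y′ ∷ ys}    len lx ly =
  last-zipWith f {x′ ∷ xs} {y′ ∷ ys} (suc-injective len) lx ly

-- Walks of states as Dyck path packings

upper lower : State → ℕ
upper (d , v) = d + v
lower (d , v) = v

stateAt : ℕ → ℕ → State
stateAt u v = (u ∸ v , v)

zipWith-stateAt : ∀ xs → zipWith stateAt (map upper xs) (map lower xs) ≡ xs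
zipWith-stateAt []             = refl
zipWith-stateAt ((d , v) ∷ xs) = cong₂ _∷_ (cong (_, v) (m+n∸n≡m d v)) (zipWith-stateAt xs)

⟶-upper : ∀ {x y} → x ⟶ y → upper y ≡ suc (upper x)
⟶-upper (rise d v) = +-suc d v
⟶-upper (fall d v) = cong suc (sym (+-suc d v))
⟶-upper (flat d)   = refl

⟷-upper : ∀ {x y} → x ⟷ y → Neighbour (λ _ → ⊥) (upper x) (upper y)
⟷-upper {x} {y} (inj₁ x⟶y) =
  subst (Neighbour (λ _ → ⊥) (upper x)) (sym (⟶-upper x⟶y)) (up (upper x))
⟷-upper {x} {y} (inj₂ y⟶x) =
  subst (λ a → Neighbour (λ _ → ⊥) a (upper y)) (sym (⟶-upper y⟶x)) (down (upper y))

⟷-lower : ∀ {x y} → x ⟷ y → Neighbour (_≡ 0) (lower x) (lower y)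
⟷-lower (inj₁ (rise d v)) = up v
⟷-lower (inj₁ (fall d v)) = down v
⟷-lower (inj₁ (flat d))   = stay refl
⟷-lower (inj₂ (rise d v)) = down v
⟷-lower (inj₂ (fall d v)) = up v
⟷-lower (inj₂ (flat d))   = stay refl

stateAt-⟷ : ∀ {h k d e} → UpOrDown d → Exact h d → Exact k e → (e ≡ H → k ≡ 0) →
            k ≤ h → move e k ≤ move d h → stateAt h k ⟷ stateAt (move d h) (move e k)
stateAt-⟷ {h}     {k}     {U} {U} _ _ _  _       _   _    = inj₁ (rise (h ∸ k) k)
stateAt-⟷ {h}     {zero}  {U} {D} _ _ () _       _   _
stateAt-⟷ {h}     {suc k} {U} {D} _ _ _  _       k<h  _   =
  inj₁ (subst (λ d′ → (h ∸ suc k , suc k) ⟶ (d′ , k)) (sym (+-∸-assoc 2 k<h)) (fall (h ∸ suc k) k))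
stateAt-⟷ {h}     {k}     {U} {H} _ _ _  on-axis _   _ with on-axis refl
... | refl = inj₁ (flat h)
stateAt-⟷ {zero}  {k}     {D} {e} _ () _  _       _   _
stateAt-⟷ {suc h} {k}     {D} {U} _ _ _  _       _   k<h  =
  inj₂ (subst (λ d′ → (h ∸ suc k , suc k) ⟶ (d′ , k)) (sym (+-∸-assoc 2 k<h)) (fall (h ∸ suc k) k))
stateAt-⟷ {suc h} {zero}  {D} {D} _ _ () _       _   _
stateAt-⟷ {suc h} {suc k} {D} {D} _ _ _  _       _   _    = inj₂ (rise (h ∸ k) k)
stateAt-⟷ {suc h} {k}     {D} {H} _ _ _  on-axis _   _ with on-axis refl
... | refl = inj₂ (flat h)
stateAt-⟷ {d = H} (inj₁ ()) _ _ _ _ _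
stateAt-⟷ {d = H} (inj₂ ()) _ _ _ _ _

walkOf : ℕ → List Step → ℕ → List Step → List State
walkOf h p k q = zipWith stateAt (heights h p) (heights k q)

walkOf-linked : ∀ {h p k q} → Nested h p k q → All UpOrDown p → FlatOnlyOnAxis k q →
                Linked _⟷_ (walkOf h p k q)
walkOf-linked {p = []}    {q = []}    _      _           _      = [-]
walkOf-linked {p = []}    {q = _ ∷ _} nested _           _      with Nested.same-length nested
... | ()
walkOf-linked {p = _ ∷ _} {q = []}    nested _           _      with Nested.same-length nested
... | ()
walkOf-linked {h} {d ∷ p} {k} {e ∷ q} nested (ud ∷ uds) onAxis =
  stateAt-⟷ {h} {k} {d} {e} ud exact-d exact-e (λ { refl → flatOnlyOnAxis-H onAxis })
            (Nested.starts-below nested) (Nested.starts-below rest)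
  ∷ walkOf-linked rest uds (flatOnlyOnAxis-tail {k} {e} exact-e onAxis)
  where
  rest    = nested-tail nested
  exact-d = staysNonNeg⇒exact (Nested.upper-nonneg nested)
  exact-e = staysNonNeg⇒exact (Nested.lower-nonneg nested)

map-upper-walkOf : ∀ {h p k q} → Nested h p k q → map upper (walkOf h p k q) ≡ heights h p
map-upper-walkOf {p = []}    {q = []}    nested = cong (_∷ []) (m∸n+n≡m (Nested.starts-below nested))
map-upper-walkOf {p = []}    {q = _ ∷ _} nested with Nested.same-length nested
... | ()
map-upper-walkOf {p = _ ∷ _} {q = []}    nested with Nested.same-length nested
... | ()
map-upper-walkOf {p = _ ∷ _} {q = _ ∷ _} nested =
  cong₂ _∷_ (m∸n+n≡m (Nested.starts-below nested)) (map-upper-walkOf (nested-tail nested))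

map-lower-walkOf : ∀ h {p} k {q} → length p ≡ length q → map lower (walkOf h p k q) ≡ heights k q
map-lower-walkOf h {[]}    k {[]}    _   = refl
map-lower-walkOf h {d ∷ p} k {e ∷ q} len =
  cong (k ∷_) (map-lower-walkOf (move d h) (move e k) (suc-injective len))

lower≤upper : ∀ x → lower x ≤ upper x
lower≤upper (d , v) = m≤n+m v d

module _ {Flat : ℕ → Set} {hs : List ℕ} (neighbours : Linked (Neighbour Flat) (0 ∷ hs)) where

  heightAt-pathThrough : ∀ i → heightAt (pathThrough (0 ∷ hs)) i ≡ + atOrLast 0 hs i
  heightAt-pathThrough i = trans (sym (ℤ.+-identityˡ _)) (height-take-pathThrough neighbours i)

  pathThrough-returns : last (0 ∷ hs) ≡ just 0 → height (pathThrough (0 ∷ hs)) ≡ + 0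
  pathThrough-returns returns = trans (sym (ℤ.+-identityˡ _)) (height-pathThrough neighbours returns)

packing⇒nested : ∀ {n p q} → IsPacking n (p , q) → Nested 0 p 0 q
packing⇒nested ((lenD , _ , nonnegD , _) , (lenE , nonnegE , _ , _) , below) = record
  { same-length  = trans lenD (sym lenE)
  ; upper-nonneg = λ i i≤ → subst (+ 0 ℤ.≤_) (from0 _) (nonnegD i (subst (i ≤_) lenD i≤))
  ; lower-nonneg = λ i i≤ → subst (+ 0 ℤ.≤_) (from0 _) (nonnegE i (subst (i ≤_) lenE i≤))
  ; below        = λ i i≤ → subst₂ ℤ._≤_ (from0 _) (from0 _) (below i (subst (i ≤_) lenD i≤))
  }
  where
  from0 : ∀ z → z ≡ + 0 ℤ.+ z
  from0 z = sym (ℤ.+-identityˡ z)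

pathsOf : List State → List Step × List Step
pathsOf xs = pathThrough (map upper xs) , pathThrough (map lower xs)

walk⇔packing : ∀ n → InverseOn (IsStateWalk n) (IsPacking n)
walk⇔packing n = record
  { to             = pathsOf
  ; from           = λ (p , q) → walkOf 0 p 0 q
  ; to-preserves   = walk⇒packing
  ; from-preserves = packing⇒walk
  ; from∘to        = from∘to
  ; to∘from        = to∘from
  }
  where
  walk⇒packing : ∀ {xs} → IsStateWalk n xs → IsPacking n (pathsOf xs)
  walk⇒packing {[]}     (_ , () , _)
  walk⇒packing {x ∷ ys} (len , refl , lst , walk) =
    (length-path upper , pathThrough-upOrDown ups , nonneg heightAt-upper ,
     pathThrough-returns ups (last-walk upper)) ,
    (length-path lower , nonneg heightAt-lower , pathThrough-returns lows (last-walk lower) ,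
     (λ i step → trans (heightAt-pathThrough lows i) (cong +_ (pathThrough-flat lows i step)))) ,
    (λ i _ → subst₂ ℤ._≤_ (sym (heightAt-lower i)) (sym (heightAt-upper i))
                          (+≤+ (lower≤upper (atOrLast x ys i))))
    where
    ups  = Linked-map⁺ (Linked.map ⟷-upper walk)
    lows = Linked-map⁺ (Linked.map ⟷-lower walk)
    length-path : (f : State → ℕ) → length (pathThrough (map f (x ∷ ys))) ≡ 2 * n
    length-path f =
      trans (length-pathThrough (f x) (map f ys)) (trans (length-map f ys) (suc-injective len))
    last-walk : (f : State → ℕ) → last (map f (x ∷ ys)) ≡ just (f x)
    last-walk f = trans (last-map f (x ∷ ys)) (cong (Maybe.map f) lst)
    heightAt-upper : ∀ i → heightAt (pathThrough (map upper (x ∷ ys))) i ≡ + upper (atOrLast x ys i)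
    heightAt-upper i = trans (heightAt-pathThrough ups i) (cong +_ (atOrLast-map upper x ys i))
    heightAt-lower : ∀ i → heightAt (pathThrough (map lower (x ∷ ys))) i ≡ + lower (atOrLast x ys i)
    heightAt-lower i = trans (heightAt-pathThrough lows i) (cong +_ (atOrLast-map lower x ys i))
    nonneg : ∀ {p} {h : ℕ → ℕ} → (∀ i → heightAt p i ≡ + h i) → ∀ i → i ≤ 2 * n → + 0 ℤ.≤ heightAt p i
    nonneg {h = h} heightAt≡ i _ = subst (+ 0 ℤ.≤_) (sym (heightAt≡ i)) (+≤+ (z≤n {h i}))

  packing⇒walk : ∀ {pq} → IsPacking n pq → IsStateWalk n (walkOf 0 (proj₁ pq) 0 (proj₂ pq))
  packing⇒walk {p , q} packing@((lenP , upOrDown , _ , endP) , (_ , _ , endQ , onAxis) , _) =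
    trans (sym (length-map upper (walkOf 0 p 0 q)))
          (trans (cong length (map-upper-walkOf nested)) (trans (length-heights 0 p) (cong suc lenP))) ,
    refl ,
    last-zipWith stateAt {heights 0 p} {heights 0 q}
      (trans (length-heights 0 p) (trans (cong suc same-length) (sym (length-heights 0 q))))
      (last-heights upper-nonneg (trans (ℤ.+-identityˡ _) endP))
      (last-heights lower-nonneg (trans (ℤ.+-identityˡ _) endQ)) ,
    walkOf-linked nested upOrDown (λ i step → trans (ℤ.+-identityˡ _) (onAxis i step))
    where
    nested = packing⇒nested {n} packing
    open Nested nested

  from∘to : ∀ {xs} → IsStateWalk n xs → walkOf 0 (proj₁ (pathsOf xs)) 0 (proj₂ (pathsOf xs)) ≡ xs
  from∘to {[]}     (_ , () , _)
  from∘to {x ∷ ys} (_ , refl , _ , walk) =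
    trans (cong₂ (zipWith stateAt) (heights-pathThrough (Linked-map⁺ (Linked.map ⟷-upper walk)))
                                   (heights-pathThrough (Linked-map⁺ (Linked.map ⟷-lower walk))))
          (zipWith-stateAt (x ∷ ys))

  to∘from : ∀ {pq} → IsPacking n pq → pathsOf (walkOf 0 (proj₁ pq) 0 (proj₂ pq)) ≡ pq
  to∘from {p , q} packing =
    cong₂ _,_ (trans (cong pathThrough (map-upper-walkOf nested)) (pathThrough-heights upper-nonneg))
              (trans (cong pathThrough (map-lower-walkOf 0 0 same-length))
                     (pathThrough-heights lower-nonneg))
    where
    nested = packing⇒nested {n} packing
    open Nested nested

theorem4p2 : (n : ℕ) → Bijection {P = IsOscDomino2 n} {Q = IsPacking n}
theorem4p2 n = inverseOn⇒bijection (inverseOn-∘ (tableau⇔walk n) (walk⇔packing n))
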